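{- Suppose $G$ is a connected graph on $n$ vertices. For each integer $1 \leq k \leq n$, if $\operatorname{dmg}_k(G) \geq 2$, then $c(G) \leq k +\operatorname{dmg}_k(G) -1$.
   Context: Cops and Robbers on a finite simple graph: in round $0$ each of $k$ cops and then the robber choose a vertex; in each later round each cop stays or moves along an edge, then the robber does the same; capture occurs when a cop occupies the robber's vertex. $c(G)$ is the cop number. A vertex is damaged if the robber occupies it in a round in which capture does not occur; $\operatorname{dmg}_k(G)$ is the minimum number of damaged vertices over games with $k$ cops when the robber places and plays to maximize damage. -}

module Defs where

open import Data.Nat using (ℕ; zero; suc; _≤_; _+_; _∸_)
open import Data.Fin using (Fin)
open import Data.List using (List; []; _∷_)
open import Data.Product using (Σ; ∃; _×_; _,_; proj₁; proj₂)
open import Data.Sum using (_⊎_)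
open import Relation.Nullary using (¬_; Dec)
open import Relation.Binary.PropositionalEquality using (_≡_; _≢_)
open import Relation.Binary.Construct.Closure.ReflexiveTransitive using (Star)
open import Function.Definitions using (Injective)

record Graph (n : ℕ) : Set₁ where
  field
    Adj     : Fin n → Fin n → Set
    adj?    : ∀ u v → Dec (Adj u v)
    symm    : ∀ {u v} → Adj u v → Adj v u
    irrefl  : ∀ {u} → ¬ Adj u u
open Graph public

Connected : ∀ {n} → Graph n → Set
Connected G = ∀ u v → Star (Adj G) u v

module Game {n : ℕ} (G : Graph n) (k : ℕ) where

  Cops : Set
  Cops = Fin k → Fin n

  Step : Fin n → Fin n → Set
  Step u v = u ≡ v ⊎ Adj G u v

  Config : Set
  Config = Cops × Fin n

  -- Strategies may depend on the whole history (past configurations,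
  -- most recent first, followed by the current configuration).
  record CopStrategy : Set where
    field
      start : Cops
      next  : List Config → Config → Cops
      legal : ∀ past cur i → Step (proj₁ cur i) (next past cur i)

  -- The robber moves after the cops and sees their new positions.
  record RobberStrategy : Set where
    field
      start : Cops → Fin n
      next  : List Config → Config → Cops → Fin n
      legal : ∀ past cur C' → Step (proj₂ cur) (next past cur C')

  module Play (cs : CopStrategy) (rs : RobberStrategy) where
    private
      module C = CopStrategy cs
      module R = RobberStrategy rs

    play : ℕ → List Config × Config
    play zero = [] , (C.start , R.start C.start)
    play (suc t) with play t
    ... | past , cur =
      let C' = C.next past cur in
      (cur ∷ past) , (C' , R.next past cur C')

    cops : ℕ → Cops
    cops t = proj₁ (proj₂ (play t))

    robber : ℕ → Fin n
    robber t = proj₂ (proj₂ (play t))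

    -- robber, sitting at robber t at the end of round t, is not caught at the
    -- end of round t nor by the cops' move in round t+1
    NotCaught : ℕ → Set
    NotCaught s = (∀ i → cops s i ≢ robber s) × (∀ i → cops (suc s) i ≢ robber s)

    Captured : Set
    Captured = Σ ℕ λ t → (∃ λ i → cops t i ≡ robber t) ⊎ (∃ λ i → cops (suc t) i ≡ robber t)

    Damaged : Fin n → Set
    Damaged v = Σ ℕ λ t → robber t ≡ v × (∀ s → s ≤ t → NotCaught s)

    AtLeastDamaged : ℕ → Set
    AtLeastDamaged d = Σ (Fin d → Fin n) λ f → Injective _≡_ _≡_ f × (∀ i → Damaged (f i))

  open Play public

  CopWin : Set
  CopWin = Σ CopStrategy λ cs → ∀ rs → Captured cs rs

  IsDmg : ℕ → Set
  IsDmg m = (Σ CopStrategy λ cs → ∀ rs → ¬ AtLeastDamaged cs rs (suc m))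
          × (∀ cs → Σ RobberStrategy λ rs → AtLeastDamaged cs rs m)

CopWin : ∀ {n} → Graph n → ℕ → Set
CopWin G k = Game.CopWin G k

IsDmg : ∀ {n} → Graph n → ℕ → ℕ → Set
IsDmg G k m = Game.IsDmg G k m

CopNumber≤ : ∀ {n} → Graph n → ℕ → Set
CopNumber≤ G j = Σ ℕ λ j' → j' ≤ j × CopWin G j'

-- Let k cops follow a strategy σ under which the robber damages at most m vertices, and add
-- m − 1 guards. The k cops play σ against the robber's actual moves, and guard j walks from a
-- fixed vertex to the j-th distinct vertex the robber visits and stays there; any cop that can
-- step onto the robber does so. As long as the robber is free, every vertex it has visited is
-- damaged in the game against σ, so it visits at most m vertices. Once it has visited no new
-- vertex for L rounds, L bounding the guards' walks, all guards are in place and the robber is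
-- on or next to one of them. Hence it must visit a new vertex every L + 1 rounds, which it can
-- do at most m times.

module Submission where

open import Defs
open import Data.Empty using (⊥-elim)
open import Data.Fin as Fin using (Fin; toℕ; fromℕ<; splitAt; _↑ˡ_; _↑ʳ_)
open import Data.Fin.Properties using (splitAt-↑ˡ; splitAt-↑ʳ; toℕ-fromℕ<; toℕ-injective; toℕ<n; any?)
  renaming (_≟_ to _≟ᶠ_)
open import Data.List using (List; []; _∷_; _++_; _∷ʳ_; [_]; length; map; allFin)
open import Data.List.Extrema.Nat using (max; v≤max⁺)
open import Data.List.Membership.Propositional using (_∈_; _∉_)
open import Data.List.Membership.Propositional.Properties
  using (∈-++⁺ˡ; ∈-++⁺ʳ; ∈-++⁻; ∈-map⁺; ∈-allFin)
open import Data.List.Properties using (length-++)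
open import Data.List.Relation.Unary.Any as Any using (here; there)
open import Data.Nat using (ℕ; zero; suc; _≤_; _<_; _+_; _∸_; z≤n; s≤s; _<?_)
open import Data.Nat.Properties
open import Data.Product using (∃; _×_; _,_; proj₁; proj₂)
open import Data.Sum using (_⊎_; inj₁; inj₂; [_,_]′)
open import Function using (_∘_)
open import Relation.Binary using (Rel; DecidableEquality)
open import Relation.Binary.Construct.Closure.ReflexiveTransitive using (Star; ε; _◅_)
open import Relation.Binary.PropositionalEquality
  using (_≡_; _≢_; refl; sym; trans; cong; cong₂; subst; module ≡-Reasoning)
open import Relation.Nullary using (¬_; Dec; yes; no)
open import Relation.Nullary.Decidable using (_⊎-dec_)

first-entry : ∀ {a} {A : Set a} (_≟_ : DecidableEquality A) (f : ℕ → A) {u} t →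
              f 0 ≢ u → f t ≡ u → ∃ λ s → s < t × f s ≢ u × f (suc s) ≡ u
first-entry _≟_ f zero f0≢u ft≡u = ⊥-elim (f0≢u ft≡u)
first-entry _≟_ f {u} (suc t) f0≢u ft≡u with f t ≟ u
... | no ft≢u = t , ≤-refl , ft≢u , ft≡u
... | yes ft≡u′ with first-entry _≟_ f t f0≢u ft≡u′
...   | s , s<t , fs≢u , fs+1≡u = s , m<n⇒m<1+n s<t , fs≢u , fs+1≡u

module FirstVisits {a} {A : Set a} (_≟_ : DecidableEquality A) (default : A) where
  open import Data.List.Membership.DecPropositional _≟_ using (_∈?_)

  nth : List A → ℕ → A
  nth []       _       = default
  nth (x ∷ xs) zero    = x
  nth (x ∷ xs) (suc i) = nth xs i

  nth-++ˡ : ∀ xs ys {i} → i < length xs → nth (xs ++ ys) i ≡ nth xs i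
  nth-++ˡ (x ∷ xs) ys {zero}  _         = refl
  nth-++ˡ (x ∷ xs) ys {suc i} (s≤s i<n) = nth-++ˡ xs ys i<n

  nth-∷ʳ-length : ∀ xs x → nth (xs ∷ʳ x) (length xs) ≡ x
  nth-∷ʳ-length []       x = refl
  nth-∷ʳ-length (_ ∷ xs) x = nth-∷ʳ-length xs x

  nth-∈ : ∀ xs {i} → i < length xs → nth xs i ∈ xs
  nth-∈ (x ∷ xs) {zero}  _         = here refl
  nth-∈ (x ∷ xs) {suc i} (s≤s i<n) = there (nth-∈ xs i<n)

  ∈⇒nth : ∀ {v} xs → v ∈ xs → ∃ λ i → i < length xs × nth xs i ≡ v
  ∈⇒nth (x ∷ xs) (here v≡x) = zero , s≤s z≤n , sym v≡x
  ∈⇒nth (x ∷ xs) (there v∈xs) with ∈⇒nth xs v∈xs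
  ... | i , i<n , eq = suc i , s≤s i<n , eq

  length-∷ʳ : ∀ (xs : List A) x → length (xs ∷ʳ x) ≡ suc (length xs)
  length-∷ʳ xs x = trans (length-++ xs) (+-comm (length xs) 1)

  ∈-of-nth-∷ʳ : ∀ xs x {i} → i < length xs → nth (xs ∷ʳ x) i ≡ x → x ∈ xs
  ∈-of-nth-∷ʳ xs x i<n eq = subst (_∈ xs) (trans (sym (nth-++ˡ xs [ x ] i<n)) eq) (nth-∈ xs i<n)

  NthInjective : List A → Set a
  NthInjective xs = ∀ {i j} → i < length xs → j < length xs → nth xs i ≡ nth xs j → i ≡ j

  ∷ʳ-nthInjective : ∀ xs x → x ∉ xs → NthInjective xs → NthInjective (xs ∷ʳ x)
  ∷ʳ-nthInjective xs x x∉xs inj {i} {j} i< j< eq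
    with m<1+n⇒m<n∨m≡n {n = length xs} (subst (i <_) (length-∷ʳ xs x) i<)
       | m<1+n⇒m<n∨m≡n {n = length xs} (subst (j <_) (length-∷ʳ xs x) j<)
  ... | inj₁ i<n | inj₁ j<n =
    inj i<n j<n (trans (sym (nth-++ˡ xs [ x ] i<n)) (trans eq (nth-++ˡ xs [ x ] j<n)))
  ... | inj₂ i≡n | inj₂ j≡n = trans i≡n (sym j≡n)
  ... | inj₁ i<n | inj₂ j≡n =
    ⊥-elim (x∉xs (∈-of-nth-∷ʳ xs x i<n (trans eq (trans (cong (nth (xs ∷ʳ x)) j≡n) (nth-∷ʳ-length xs x)))))
  ... | inj₂ i≡n | inj₁ j<n =
    ⊥-elim (x∉xs (∈-of-nth-∷ʳ xs x j<n (trans (sym eq) (trans (cong (nth (xs ∷ʳ x)) i≡n) (nth-∷ʳ-length xs x)))))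

  -- The argument lists positions most recent first; the result lists the distinct ones in order
  -- of first occurrence, so that an entry keeps its index as the list grows.
  firstVisits : List A → List A
  firstVisits []       = []
  firstVisits (x ∷ xs) with x ∈? firstVisits xs
  ... | yes _ = firstVisits xs
  ... | no _  = firstVisits xs ∷ʳ x

  firstVisits-∷ : ∀ x xs → (x ∈ firstVisits xs × firstVisits (x ∷ xs) ≡ firstVisits xs)
                          ⊎ (x ∉ firstVisits xs × firstVisits (x ∷ xs) ≡ firstVisits xs ∷ʳ x)
  firstVisits-∷ x xs with x ∈? firstVisits xs
  ... | yes x∈ = inj₁ (x∈ , refl)
  ... | no x∉  = inj₂ (x∉ , refl)

  firstVisits-[_] : ∀ x → firstVisits (x ∷ []) ≡ x ∷ []
  firstVisits-[ x ] with x ∈? []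
  ... | no _ = refl

  length-firstVisits-∷ : ∀ x xs → length (firstVisits xs) ≤ length (firstVisits (x ∷ xs))
  length-firstVisits-∷ x xs with firstVisits-∷ x xs
  ... | inj₁ (_ , eq) rewrite eq = ≤-refl
  ... | inj₂ (_ , eq) rewrite eq | length-∷ʳ (firstVisits xs) x = n≤1+n _

  nth-firstVisits-∷ : ∀ x xs {i} → i < length (firstVisits xs) →
                      nth (firstVisits (x ∷ xs)) i ≡ nth (firstVisits xs) i
  nth-firstVisits-∷ x xs i<n with firstVisits-∷ x xs
  ... | inj₁ (_ , eq) rewrite eq = refl
  ... | inj₂ (_ , eq) rewrite eq = nth-++ˡ (firstVisits xs) [ x ] i<n

  firstVisits-∷⁺ : ∀ {v} x xs → v ∈ firstVisits xs → v ∈ firstVisits (x ∷ xs)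
  firstVisits-∷⁺ x xs v∈ with firstVisits-∷ x xs
  ... | inj₁ (_ , eq) rewrite eq = v∈
  ... | inj₂ (_ , eq) rewrite eq = ∈-++⁺ˡ v∈

  head∈firstVisits : ∀ x xs → x ∈ firstVisits (x ∷ xs)
  head∈firstVisits x xs with firstVisits-∷ x xs
  ... | inj₁ (x∈ , eq) rewrite eq = x∈
  ... | inj₂ (_ , eq)  rewrite eq = ∈-++⁺ʳ (firstVisits xs) (here refl)

  firstVisits-∷-nonempty : ∀ x xs → 0 < length (firstVisits (x ∷ xs))
  firstVisits-∷-nonempty x xs with firstVisits (x ∷ xs) | head∈firstVisits x xs
  ... | _ ∷ _ | _ = s≤s z≤n

  firstVisits⊆ : ∀ {v} xs → v ∈ firstVisits xs → v ∈ xs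
  firstVisits⊆ (x ∷ xs) v∈ with firstVisits-∷ x xs
  ... | inj₁ (_ , eq) rewrite eq = there (firstVisits⊆ xs v∈)
  ... | inj₂ (_ , eq) rewrite eq with ∈-++⁻ (firstVisits xs) v∈
  ...   | inj₁ v∈xs      = there (firstVisits⊆ xs v∈xs)
  ...   | inj₂ (here eq) = here eq

  firstVisits-nthInjective : ∀ xs → NthInjective (firstVisits xs)
  firstVisits-nthInjective []       ()
  firstVisits-nthInjective (x ∷ xs) with firstVisits-∷ x xs
  ... | inj₁ (_ , eq)  rewrite eq = firstVisits-nthInjective xs
  ... | inj₂ (x∉ , eq) rewrite eq = ∷ʳ-nthInjective (firstVisits xs) x x∉ (firstVisits-nthInjective xs)

module Walks {a ℓ} {A : Set a} (R : Rel A ℓ) where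

  walkLength : ∀ {u v} → Star R u v → ℕ
  walkLength ε       = 0
  walkLength (_ ◅ w) = suc (walkLength w)

  walkAt : ∀ {u v} → Star R u v → ℕ → A
  walkAt {u} ε       _       = u
  walkAt {u} (_ ◅ w) zero    = u
  walkAt     (_ ◅ w) (suc i) = walkAt w i

  walkAt-zero : ∀ {u v} (w : Star R u v) → walkAt w 0 ≡ u
  walkAt-zero ε       = refl
  walkAt-zero (_ ◅ w) = refl

  walkAt-suc : ∀ {u v} (w : Star R u v) i →
               walkAt w i ≡ walkAt w (suc i) ⊎ R (walkAt w i) (walkAt w (suc i))
  walkAt-suc ε         i       = inj₁ refl
  walkAt-suc {u} (x ◅ w) zero  = inj₂ (subst (R u) (sym (walkAt-zero w)) x)
  walkAt-suc (_ ◅ w) (suc i)   = walkAt-suc w i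

  walkAt-end : ∀ {u v} (w : Star R u v) {i} → walkLength w ≤ i → walkAt w i ≡ v
  walkAt-end ε       _         = refl
  walkAt-end (_ ◅ w) (s≤s l≤i) = walkAt-end w l≤i

module Pursuit {n : ℕ} (G : Graph n) where

  Move : Fin n → Fin n → Set
  Move u v = u ≡ v ⊎ Adj G u v

  move? : ∀ u v → Dec (Move u v)
  move? u v = (u ≟ᶠ v) ⊎-dec adj? G u v

  pursue : Fin n → Fin n → Fin n → Fin n
  pursue x r d with move? x r
  ... | yes _ = r
  ... | no _ with move? x d
  ...   | yes _ = d
  ...   | no _  = x

  pursue-move : ∀ x r d → Move x (pursue x r d)
  pursue-move x r d with move? x r
  ... | yes x→r = x→r
  ... | no _ with move? x d
  ...   | yes x→d = x→d
  ...   | no _    = inj₁ refl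

  pursue-catches : ∀ x r d → Move x r → pursue x r d ≡ r
  pursue-catches x r d x→r with move? x r
  ... | yes _  = refl
  ... | no x↛r = ⊥-elim (x↛r x→r)

  pursue-heads : ∀ x r d → ¬ Move x r → Move x d → pursue x r d ≡ d
  pursue-heads x r d x↛r x→d with move? x r
  ... | yes x→r = ⊥-elim (x↛r x→r)
  ... | no _ with move? x d
  ...   | yes _  = refl
  ...   | no x↛d = ⊥-elim (x↛d x→d)

module Histories {n : ℕ} (G : Graph n) (k : ℕ) where
  open Game G k

  history : CopStrategy → Fin n → List (Fin n) → List Config × Config
  history cs r []       = [] , (CopStrategy.start cs , r)
  history cs r (r′ ∷ ρ) =
    let h = history cs r′ ρ in (proj₂ h ∷ proj₁ h) , (CopStrategy.next cs (proj₁ h) (proj₂ h) , r)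

  history-robber : ∀ cs r ρ → proj₂ (proj₂ (history cs r ρ)) ≡ r
  history-robber cs r []      = refl
  history-robber cs r (_ ∷ _) = refl

  module _ (cs : CopStrategy) (rs : RobberStrategy) where

    -- the robber's positions before round t, most recent first
    trail : ℕ → List (Fin n)
    trail t = map proj₂ (proj₁ (play cs rs t))

    play≡history : ∀ t → play cs rs t ≡ history cs (robber cs rs t) (trail t)
    play≡history zero    = refl
    play≡history (suc t) =
      cong (λ h → (proj₂ h ∷ proj₁ h) , (CopStrategy.next cs (proj₁ h) (proj₂ h) , robber cs rs (suc t)))
           (play≡history t)

    ∈-trail : ∀ {v} t → v ∈ trail t → ∃ λ s → s < t × robber cs rs s ≡ v
    ∈-trail (suc t) (here v≡r) = t , ≤-refl , sym v≡r
    ∈-trail (suc t) (there v∈) with ∈-trail t v∈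
    ... | s , s<t , eq = s , m<n⇒m<1+n s<t , eq

    NoCaptureBefore : ℕ → Set
    NoCaptureBefore t = ∀ s → s < t → NotCaught cs rs s

    noCaptureBefore-mono : ∀ {t t′} → t ≤ t′ → NoCaptureBefore t′ → NoCaptureBefore t
    noCaptureBefore-mono t≤t′ h s s<t = h s (≤-trans s<t t≤t′)

    noCaptureBefore⊎captured : ∀ t → NoCaptureBefore t ⊎ Captured cs rs
    noCaptureBefore⊎captured zero = inj₁ (λ _ ())
    noCaptureBefore⊎captured (suc t) with noCaptureBefore⊎captured t
    ... | inj₂ c = inj₂ c
    ... | inj₁ h with any? (λ i → cops cs rs t i ≟ᶠ robber cs rs t)
    ...   | yes c = inj₂ (t , inj₁ c)
    ...   | no ¬c with any? (λ i → cops cs rs (suc t) i ≟ᶠ robber cs rs t)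
    ...     | yes c′ = inj₂ (t , inj₂ c′)
    ...     | no ¬c′ = inj₁ λ s s<1+t →
      [ h s , (λ { refl → (λ i e → ¬c (i , e)) , (λ i e → ¬c′ (i , e)) }) ]′ (m<1+n⇒m<n∨m≡n s<1+t)

module Augmentation {n : ℕ} (G : Graph n) (conn : Connected G) (base : Fin n) (k e : ℕ)
                    (cs : Game.CopStrategy G k) where
  open FirstVisits _≟ᶠ_ base
  open Walks (Adj G)
  open Pursuit G
  module Few  = Game G k
  module Aug  = Game G (k + e)
  module FewH = Histories G k
  module AugH = Histories G (k + e)
  module CS   = Few.CopStrategy cs

  route : ∀ v → Star (Adj G) base v
  route = conn base

  L : ℕ
  L = max 0 (map (walkLength ∘ route) (allFin n))

  walkLength-route≤L : ∀ v → walkLength (route v) ≤ L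
  walkLength-route≤L v =
    v≤max⁺ 0 _ (inj₂ (Any.map ≤-reflexive (∈-map⁺ (walkLength ∘ route) (∈-allFin v))))

  -- number of rounds since the j-th vertex of the trail was first visited
  age : ℕ → List (Fin n) → ℕ
  age j []       = 0
  age j (x ∷ ρ) with j <? length (firstVisits (x ∷ ρ))
  ... | yes _ = suc (age j ρ)
  ... | no _  = 0

  age-∷ : ∀ j x ρ → j < length (firstVisits (x ∷ ρ)) → age j (x ∷ ρ) ≡ suc (age j ρ)
  age-∷ j x ρ j<n with j <? length (firstVisits (x ∷ ρ))
  ... | yes _  = refl
  ... | no j≮n = ⊥-elim (j≮n j<n)

  age-unvisited : ∀ j ρ → ¬ j < length (firstVisits ρ) → age j ρ ≡ 0
  age-unvisited j []      _    = refl
  age-unvisited j (x ∷ ρ) j≮n with j <? length (firstVisits (x ∷ ρ))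
  ... | yes j<n = ⊥-elim (j≮n j<n)
  ... | no _    = refl

  guard : ℕ → List (Fin n) → Fin n
  guard j ρ = walkAt (route (nth (firstVisits ρ) j)) (age j ρ)

  guard-unvisited : ∀ j ρ → ¬ j < length (firstVisits ρ) → guard j ρ ≡ base
  guard-unvisited j ρ j≮n rewrite age-unvisited j ρ j≮n = walkAt-zero (route (nth (firstVisits ρ) j))

  guard-move : ∀ j x ρ → Move (guard j ρ) (guard j (x ∷ ρ))
  guard-move j x ρ with j <? length (firstVisits (x ∷ ρ)) | j <? length (firstVisits ρ)
  ... | no j≮n′ | _ =
    inj₁ (trans (guard-unvisited j ρ (j≮n′ ∘ λ j<n → ≤-trans j<n (length-firstVisits-∷ x ρ)))
                (sym (walkAt-zero (route (nth (firstVisits (x ∷ ρ)) j)))))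
  ... | yes _ | yes j<n rewrite nth-firstVisits-∷ x ρ j<n =
    walkAt-suc (route (nth (firstVisits ρ) j)) (age j ρ)
  ... | yes _ | no j≮n
    rewrite age-unvisited j ρ j≮n | walkAt-zero (route (nth (firstVisits ρ) j))
    with walkAt-suc (route (nth (firstVisits (x ∷ ρ)) j)) 0
  ...   | first-step rewrite walkAt-zero (route (nth (firstVisits (x ∷ ρ)) j)) = first-step

  originalMoves : Fin n → List (Fin n) → Few.Cops
  originalMoves r ρ = CS.next (proj₁ h) (proj₂ h)
    where h = FewH.history cs r ρ

  destination : Fin (k + e) → Fin n → List (Fin n) → Fin n
  destination i r ρ = [ originalMoves r ρ , (λ j → guard (toℕ j) (r ∷ ρ)) ]′ (splitAt k i)

  destination-↑ˡ : ∀ a r ρ → destination (a ↑ˡ e) r ρ ≡ originalMoves r ρ a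
  destination-↑ˡ a r ρ rewrite splitAt-↑ˡ k a e = refl

  destination-↑ʳ : ∀ j r ρ → destination (k ↑ʳ j) r ρ ≡ guard (toℕ j) (r ∷ ρ)
  destination-↑ʳ j r ρ rewrite splitAt-↑ʳ k e j = refl

  start : Aug.Cops
  start i = [ CS.start , (λ _ → base) ]′ (splitAt k i)

  start-↑ˡ : ∀ a → start (a ↑ˡ e) ≡ CS.start a
  start-↑ˡ a rewrite splitAt-↑ˡ k a e = refl

  start-↑ʳ : ∀ j → start (k ↑ʳ j) ≡ base
  start-↑ʳ j rewrite splitAt-↑ʳ k e j = refl

  augmented : Aug.CopStrategy
  augmented = record
    { start = start
    ; next  = λ past cur i →
                pursue (proj₁ cur i) (proj₂ cur) (destination i (proj₂ cur) (map proj₂ past))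
    ; legal = λ past cur i → pursue-move _ _ _
    }

  module AS = Aug.CopStrategy augmented

  module Run (few : ∀ rs → ¬ Few.AtLeastDamaged cs rs (suc (suc e))) (1≤e : 1 ≤ e)
             (rs : Aug.RobberStrategy) where
    module RS = Aug.RobberStrategy rs

    reply : List Aug.Config × Aug.Config → Fin n
    reply h = RS.next (proj₁ h) (proj₂ h) (AS.next (proj₁ h) (proj₂ h))

    reply-move : ∀ h x → proj₂ (proj₂ h) ≡ x → Move x (reply h)
    reply-move h x refl = RS.legal (proj₁ h) (proj₂ h) (AS.next (proj₁ h) (proj₂ h))

    -- in every position it answers as rs answers the augmented team
    shadow : Few.RobberStrategy
    shadow = record
      { start = λ _ → RS.start start
      ; next  = λ past cur _ → reply (AugH.history augmented (proj₂ cur) (map proj₂ past))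
      ; legal = λ past cur _ → reply-move (AugH.history augmented (proj₂ cur) (map proj₂ past)) (proj₂ cur)
                                          (AugH.history-robber augmented (proj₂ cur) (map proj₂ past))
      }

    r : ℕ → Fin n
    r = Aug.robber augmented rs

    ρ : ℕ → List (Fin n)
    ρ = AugH.trail augmented rs

    cop : ℕ → Aug.Cops
    cop = Aug.cops augmented rs

    NoCap : ℕ → Set
    NoCap = AugH.NoCaptureBefore augmented rs

    narrow : ∀ {t t′} → t′ ≤ t → NoCap t → NoCap t′
    narrow = AugH.noCaptureBefore-mono augmented rs

    shadow-tracks : ∀ t → Few.robber cs shadow t ≡ r t × FewH.trail cs shadow t ≡ ρ t
    shadow-tracks zero    = refl , refl
    shadow-tracks (suc t) with shadow-tracks t
    ... | r≡ , ρ≡ = trans (cong reply (cong₂ (AugH.history augmented) r≡ ρ≡))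
                          (cong reply (sym (AugH.play≡history augmented rs t)))
                  , cong₂ _∷_ r≡ ρ≡

    out-of-reach : ∀ t → Aug.NotCaught augmented rs t → ∀ c → ¬ Move (cop t c) (r t)
    out-of-reach t (_ , not-caught-next) c reach = not-caught-next c (pursue-catches _ _ _ reach)

    originalMoves-shadow : ∀ t a → originalMoves (r t) (ρ t) a ≡ Few.cops cs shadow (suc t) a
    originalMoves-shadow t a =
      cong (λ h → CS.next (proj₁ h) (proj₂ h) a)
           (trans (cong₂ (FewH.history cs) (sym (proj₁ (shadow-tracks t))) (sym (proj₂ (shadow-tracks t))))
                  (sym (FewH.play≡history cs shadow t)))

    originals-agree : ∀ t → NoCap t → ∀ a → cop t (a ↑ˡ e) ≡ Few.cops cs shadow t a
    originals-agree zero    _ a = start-↑ˡ a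
    originals-agree (suc t) h a =
      trans (pursue-heads _ _ _ (out-of-reach t (h t ≤-refl) (a ↑ˡ e)) move)
            (trans (destination-↑ˡ a (r t) (ρ t)) (originalMoves-shadow t a))
      where
      move : Move (cop t (a ↑ˡ e)) (destination (a ↑ˡ e) (r t) (ρ t))
      move rewrite originals-agree t (narrow (n≤1+n t) h) a
                 | destination-↑ˡ a (r t) (ρ t) | originalMoves-shadow t a = CS.legal _ _ a

    guards-agree : ∀ t → NoCap t → ∀ j → cop t (k ↑ʳ j) ≡ guard (toℕ j) (ρ t)
    guards-agree zero    _ j = trans (start-↑ʳ j) (sym (walkAt-zero (route base)))
    guards-agree (suc t) h j =
      trans (pursue-heads _ _ _ (out-of-reach t (h t ≤-refl) (k ↑ʳ j)) move)
            (destination-↑ʳ j (r t) (ρ t))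
      where
      move : Move (cop t (k ↑ʳ j)) (destination (k ↑ʳ j) (r t) (ρ t))
      move rewrite guards-agree t (narrow (n≤1+n t) h) j
                 | destination-↑ʳ j (r t) (ρ t) = guard-move (toℕ j) (r t) (ρ t)

    visited : ℕ → List (Fin n)
    visited t = firstVisits (ρ t)

    #visited : ℕ → ℕ
    #visited t = length (visited t)

    #visited-mono : ∀ t d → #visited t ≤ #visited (d + t)
    #visited-mono t zero    = ≤-refl
    #visited-mono t (suc d) = ≤-trans (#visited-mono t d) (length-firstVisits-∷ (r (d + t)) (ρ (d + t)))

    nth-visited-stable : ∀ t d {i} → i < #visited t → nth (visited (d + t)) i ≡ nth (visited t) i
    nth-visited-stable t zero    _   = refl
    nth-visited-stable t (suc d) i<n =
      trans (nth-firstVisits-∷ (r (d + t)) (ρ (d + t)) (≤-trans i<n (#visited-mono t d)))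
            (nth-visited-stable t d i<n)

    visited-complete : ∀ t s → s < t → r s ∈ visited t
    visited-complete (suc t) s s<1+t with m<1+n⇒m<n∨m≡n s<1+t
    ... | inj₁ s<t  = firstVisits-∷⁺ (r t) (ρ t) (visited-complete t s s<t)
    ... | inj₂ refl = head∈firstVisits (r t) (ρ t)

    visited-first : ∀ t → nth (visited (suc t)) 0 ≡ r 0
    visited-first zero    = cong (λ xs → nth xs 0) firstVisits-[ r 0 ]
    visited-first (suc t) =
      trans (nth-firstVisits-∷ (r (suc t)) (ρ (suc t)) (firstVisits-∷-nonempty (r t) (ρ t)))
            (visited-first t)

    age-grows : ∀ t j → j < #visited t → ∀ d → d ≤ age j (ρ (d + t))
    age-grows t j j<n zero    = z≤n
    age-grows t j j<n (suc d)
      rewrite age-∷ j (r (d + t)) (ρ (d + t)) (≤-trans j<n (#visited-mono t (suc d))) =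
      s≤s (age-grows t j j<n d)

    shadow-not-caught : ∀ t → NoCap t → FewH.NoCaptureBefore cs shadow t
    shadow-not-caught t h s s<t =
      not-on (narrow (<⇒≤ s<t) h) (proj₁ (h s s<t)) , not-on (narrow s<t h) (proj₂ (h s s<t))
      where
      not-on : ∀ {t′} → NoCap t′ → (∀ c → cop t′ c ≢ r s) →
               ∀ a → Few.cops cs shadow t′ a ≢ Few.robber cs shadow s
      not-on h′ free a eq = free (a ↑ˡ e) (trans (originals-agree _ h′ a) (trans eq (proj₁ (shadow-tracks s))))

    visited-damaged : ∀ t → NoCap t → ∀ {v} → v ∈ visited t → Few.Damaged cs shadow v
    visited-damaged t h v∈ with AugH.∈-trail augmented rs t (firstVisits⊆ (ρ t) v∈)
    ... | s , s<t , r≡v =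
      s , trans (proj₁ (shadow-tracks s)) r≡v , λ s′ s′≤s → shadow-not-caught t h s′ (≤-<-trans s′≤s s<t)

    visited-damage : ∀ t → NoCap t → ∀ {d} → d ≤ #visited t → Few.AtLeastDamaged cs shadow d
    visited-damage t h d≤n =
      (λ i → nth (visited t) (toℕ i)) ,
      (λ eq → toℕ-injective (firstVisits-nthInjective (ρ t) (below _) (below _) eq)) ,
      (λ i → visited-damaged t h (nth-∈ (visited t) (below i)))
      where
      below : ∀ i → toℕ i < #visited t
      below i = <-≤-trans (toℕ<n i) d≤n

    few-visited : ∀ t → NoCap t → #visited t ≤ suc e
    few-visited t h = ≮⇒≥ λ e+1<n → few shadow (visited-damage t h e+1<n)

    guard-settled : ∀ t → NoCap (L + t) → ∀ {j} (j<e : j < e) → j < #visited t →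
                    cop (L + t) (k ↑ʳ fromℕ< j<e) ≡ nth (visited (suc (L + t))) j
    guard-settled t h {j} j<e j<n = begin
      cop (L + t) (k ↑ʳ fromℕ< j<e)
        ≡⟨ guards-agree (L + t) h (fromℕ< j<e) ⟩
      guard (toℕ (fromℕ< j<e)) (ρ (L + t))
        ≡⟨ cong (λ i → guard i (ρ (L + t))) (toℕ-fromℕ< j<e) ⟩
      guard j (ρ (L + t))
        ≡⟨ walkAt-end (route _) (≤-trans (walkLength-route≤L _) (age-grows t j j<n L)) ⟩
      nth (visited (L + t)) j
        ≡⟨ nth-firstVisits-∷ (r (L + t)) (ρ (L + t)) (≤-trans j<n (#visited-mono t L)) ⟨
      nth (visited (suc (L + t))) j
        ∎
      where open ≡-Reasoning

    entered-from-neighbour : ∀ t → r 0 ≢ r t → ∃ λ s → s < t × r s ≢ r t × Adj G (r s) (r t)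
    entered-from-neighbour t r0≢rt with first-entry _≟ᶠ_ r t r0≢rt refl
    ... | s , s<t , rs≢rt , rs+1≡rt with RS.legal _ _ _
    ...   | inj₁ rs≡rs+1 = ⊥-elim (rs≢rt (trans rs≡rs+1 rs+1≡rt))
    ...   | inj₂ adj     = s , s<t , rs≢rt , subst (Adj G (r s)) rs+1≡rt adj

    -- If no new vertex was visited for L rounds, every visited vertex is guarded. The robber's
    -- vertex is then guarded itself, unless it is the last one visited, whose guard may still be
    -- missing; but the robber entered it from an earlier visited vertex, whose guard is adjacent.
    robber-in-reach : ∀ t → NoCap (suc (L + t)) → #visited t ≡ #visited (suc (L + t)) →
                      ∃ λ c → Move (cop (L + t) c) (r (L + t))
    robber-in-reach t h same =
      in-reach (∈⇒nth (visited (suc t′)) (head∈firstVisits (r t′) (ρ t′)))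
      where
      t′ : ℕ
      t′ = L + t

      bound : #visited (suc t′) ≤ suc e
      bound = few-visited (suc t′) h

      guarded : ∀ {j} → j < #visited (suc t′) → (j<e : j < e) →
                cop t′ (k ↑ʳ fromℕ< j<e) ≡ nth (visited (suc t′)) j
      guarded {j} j<n j<e = guard-settled t (narrow (n≤1+n _) h) j<e (subst (j <_) (sym same) j<n)

      not-first : ∀ {i} → i < #visited (suc t′) → nth (visited (suc t′)) i ≡ r t′ → 0 < i → r 0 ≢ r t′
      not-first i<n i↦u 0<i r0≡u =
        <⇒≢ 0<i (firstVisits-nthInjective (ρ (suc t′)) (firstVisits-∷-nonempty (r t′) (ρ t′)) i<n
                                          (trans (visited-first t′) (trans r0≡u (sym i↦u))))

      in-reach : (∃ λ i → i < #visited (suc t′) × nth (visited (suc t′)) i ≡ r t′) →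
                 ∃ λ c → Move (cop t′ c) (r t′)
      in-reach (i , i<n , i↦u) with m<1+n⇒m<n∨m≡n (≤-trans i<n bound)
      ... | inj₁ i<e = k ↑ʳ fromℕ< i<e , inj₁ (trans (guarded i<n i<e) i↦u)
      ... | inj₂ i≡e
        with entered-from-neighbour t′ (not-first i<n i↦u (≤-trans 1≤e (≤-reflexive (sym i≡e))))
      ...   | s , s<t′ , rs≢u , adj
        with ∈⇒nth (visited (suc t′)) (visited-complete (suc t′) s (m<n⇒m<1+n s<t′))
      ...     | p , p<n , p↦rs =
        k ↑ʳ fromℕ< p<e , inj₂ (subst (λ v → Adj G v (r t′)) (sym (trans (guarded p<n p<e) p↦rs)) adj)
        where
        p<e : p < e
        p<e = ≤∧≢⇒< (m<1+n⇒m≤n (≤-trans p<n bound))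
                    (λ p≡e → rs≢u (trans (sym p↦rs)
                                         (trans (cong (nth (visited (suc t′))) (trans p≡e (sym i≡e))) i↦u)))

    visited-grows : ∀ t → NoCap (suc (L + t)) → #visited t < #visited (suc (L + t))
    visited-grows t h = ≤∧≢⇒< (#visited-mono t (suc L)) λ same →
      let c , reach = robber-in-reach t h same in out-of-reach (L + t) (h (L + t) ≤-refl) c reach

    checkpoint : ℕ → ℕ
    checkpoint zero    = 1
    checkpoint (suc i) = suc (L + checkpoint i)

    visited-at-checkpoint : ∀ i → NoCap (checkpoint i) → suc i ≤ #visited (checkpoint i)
    visited-at-checkpoint zero    _ = firstVisits-∷-nonempty (r 0) []
    visited-at-checkpoint (suc i) h =
      ≤-trans (s≤s (visited-at-checkpoint i (narrow (m≤n+m _ (suc L)) h)))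
              (visited-grows (checkpoint i) h)

    captured : Aug.Captured augmented rs
    captured with AugH.noCaptureBefore⊎captured augmented rs (checkpoint (suc e))
    ... | inj₂ c = c
    ... | inj₁ h = ⊥-elim (1+n≰n (≤-trans (visited-at-checkpoint (suc e) h) (few-visited _ h)))

lemma4p1 : ∀ (n : ℕ) (G : Graph n) → Connected G →
    ∀ (k : ℕ) → 1 ≤ k → k ≤ n →
    ∀ (m : ℕ) → IsDmg G k m → 2 ≤ m →
    CopNumber≤ G (k + m ∸ 1)
lemma4p1 zero G conn k 1≤k k≤0 m _ _ = ⊥-elim (1+n≰n (≤-trans 1≤k k≤0))
lemma4p1 (suc n) G conn k 1≤k k≤n (suc (suc m)) ((cs , few) , _) (s≤s (s≤s _)) =
  k + suc m , ≤-reflexive (sym (cong (_∸ 1) (+-suc k (suc m)))) , augmented , Run.captured few (s≤s z≤n)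
  where open Augmentation G conn Fin.zero k (suc m) cs
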